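{- Let $R^1,R^2,S^1,S^2\in\mathfrak{P}$ with $R^1\cap R^2=\emptyset$ and $S^1\cap S^2=\emptyset$. If $R^1\sqsubseteq S^1$ and $R^2\sqsubseteq S^2$, then $R^1\oplus R^2\sqsubseteq S^1\oplus S^2$. If $R^1\sqsubseteq_G S^1$ and $R^2\sqsubseteq_G S^2$, then $R^1\oplus R^2\sqsubseteq_G S^1\oplus S^2$.
   Context: $\mathfrak{P}$ is the class of finite nonempty posets and $\mathfrak{P}_r$ a fixed system of representatives of its isomorphism classes. $A\oplus B$ is the ordinal sum of disjoint posets (disjoint union, every element of $A$ below every element of $B$). $\mathcal{H}(P,Q)$ is the set of order-preserving maps $P\to Q$. For $A\subseteq P$, $x\in A$: $\gamma_A(x)$ is the set of $y\in A$ joined to $x$ by a sequence $x=z_0,\dots,z_L=y$ in $A$ ($L\ge0$) with consecutive elements strictly comparable; for a map $\xi$ on $P$, $G_\xi(x):=\gamma_{\xi^{ -1}(\xi(x))}(x)$. A Hom-scheme from $R$ to $S$ is a family $(\rho_P)_{P\in\mathfrak{P}_r}$ of maps $\rho_P:\mathcal{H}(P,R)\to\mathcal{H}(P,S)$; strong if every $\rho_P$ is injective; a G-scheme if $G_{\rho_P(\xi)}(x)=G_\xi(x)$ for all $P\in\mathfrak{P}_r$, $\xi\in\mathcal{H}(P,R)$, $x\in P$. $R\sqsubseteq S$ / $R\sqsubseteq_G S$ mean existence of a strong Hom-scheme / strong G-scheme from $R$ to $S$. -}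

module Defs where

open import Level using (Level)
open import Data.Nat using (ℕ; suc; _+_)
open import Data.Fin using (Fin)
open import Data.Fin.Properties using (+↔⊎)
open import Data.Sum using (_⊎_; inj₁; inj₂)
open import Data.Sum.Function.Propositional using (_⊎-↔_)
open import Data.Product using (Σ; _×_; _,_; proj₁; proj₂)
open import Data.Unit using (⊤; tt)
open import Data.Empty using (⊥)
open import Function using (_↔_)
open import Function.Construct.Composition using (_↔-∘_)
open import Function.Construct.Symmetry using (↔-sym)
open import Relation.Nullary using (¬_)
open import Relation.Binary.Structures using (IsPartialOrder; IsPreorder)
open import Relation.Binary.PropositionalEquality
  using (_≡_; refl; cong; isEquivalence; sym; trans)

-- Finite nonempty posets (the class 𝔓).
-- The carrier is in bijection with Fin (suc k), i.e. has k+1 ≥ 1 elements.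

record FinPoset : Set₁ where
  field
    Carrier   : Set
    _≤_       : Carrier → Carrier → Set
    isPO      : IsPartialOrder _≡_ _≤_
    k         : ℕ
    enum      : Carrier ↔ Fin (suc k)

  _<_ : Carrier → Carrier → Set
  x < y = (x ≤ y) × ¬ (x ≡ y)

open FinPoset public

module _ (A B : FinPoset) where
  private
    module A = FinPoset A
    module B = FinPoset B
    module PA = IsPartialOrder (FinPoset.isPO A)
    module PB = IsPartialOrder (FinPoset.isPO B)

  data _≤⊕_ : A.Carrier ⊎ B.Carrier → A.Carrier ⊎ B.Carrier → Set where
    ≤-AA : ∀ {a a'} → a A.≤ a' → inj₁ a ≤⊕ inj₁ a'
    ≤-AB : ∀ {a b}  → inj₁ a ≤⊕ inj₂ b
    ≤-BB : ∀ {b b'} → b B.≤ b' → inj₂ b ≤⊕ inj₂ b'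

  private
    ⊕-refl : ∀ {x y} → x ≡ y → x ≤⊕ y
    ⊕-refl {inj₁ a} refl = ≤-AA PA.refl
    ⊕-refl {inj₂ b} refl = ≤-BB PB.refl

    ⊕-trans : ∀ {x y z} → x ≤⊕ y → y ≤⊕ z → x ≤⊕ z
    ⊕-trans (≤-AA p) (≤-AA q) = ≤-AA (PA.trans p q)
    ⊕-trans (≤-AA p) ≤-AB     = ≤-AB
    ⊕-trans ≤-AB     (≤-BB q) = ≤-AB
    ⊕-trans (≤-BB p) (≤-BB q) = ≤-BB (PB.trans p q)

    ⊕-antisym : ∀ {x y} → x ≤⊕ y → y ≤⊕ x → x ≡ y
    ⊕-antisym (≤-AA p) (≤-AA q) = cong inj₁ (PA.antisym p q)
    ⊕-antisym (≤-BB p) (≤-BB q) = cong inj₂ (PB.antisym p q)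

    ⊕-isPO : IsPartialOrder _≡_ _≤⊕_
    ⊕-isPO = record
      { isPreorder = record
        { isEquivalence = isEquivalence
        ; reflexive     = ⊕-refl
        ; trans         = ⊕-trans
        }
      ; antisym = ⊕-antisym
      }

  _⊕_ : FinPoset
  _⊕_ = record
    { Carrier = A.Carrier ⊎ B.Carrier
    ; _≤_     = _≤⊕_
    ; isPO    = ⊕-isPO
    ; k       = A.k + suc B.k
    ; enum    = ↔-sym (+↔⊎ {suc A.k} {suc B.k}) ↔-∘ (A.enum ⊎-↔ B.enum)
    }

record Hom (P Q : FinPoset) : Set where
  field
    fun  : Carrier P → Carrier Q
    mono : ∀ {x y} → _≤_ P x y → _≤_ Q (fun x) (fun y)

open Hom public

_≗H_ : ∀ {P Q} → Hom P Q → Hom P Q → Set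
_≗H_ {P} f g = ∀ (x : Carrier P) → fun f x ≡ fun g x

-- G_ξ(x) = γ_{ξ⁻¹(ξ(x))}(x): the y reachable from x by a chain
-- x = z₀, …, z_L = y (L ≥ 0) of elements of the fibre ξ⁻¹(ξ(x)),
-- consecutive elements strictly comparable.

data InG (P Q : FinPoset) (ξ : Carrier P → Carrier Q) (x : Carrier P)
         : Carrier P → Set where
  here : InG P Q ξ x x
  step : ∀ {y z} → InG P Q ξ x y → ξ z ≡ ξ x
       → (_<_ P y z ⊎ _<_ P z y) → InG P Q ξ x z

-- Hom-schemes. The index P ranges over all finite nonempty posets
-- (existence-equivalent to indexing by 𝔓_r).

HomScheme : FinPoset → FinPoset → Set₁
HomScheme R S = (P : FinPoset) → Hom P R → Hom P S

IsStrong : ∀ {R S} → HomScheme R S → Set₁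
IsStrong {R} ρ = (P : FinPoset) (ξ ξ' : Hom P R) → ρ P ξ ≗H ρ P ξ' → ξ ≗H ξ'

IsGScheme : ∀ {R S} → HomScheme R S → Set₁
IsGScheme {R} {S} ρ = (P : FinPoset) (ξ : Hom P R) (x y : Carrier P)
  → (InG P S (fun (ρ P ξ)) x y → InG P R (fun ξ) x y)
  × (InG P R (fun ξ) x y → InG P S (fun (ρ P ξ)) x y)

_⊑_ : FinPoset → FinPoset → Set₁
R ⊑ S = Σ (HomScheme R S) IsStrong

_⊑G_ : FinPoset → FinPoset → Set₁
R ⊑G S = Σ (HomScheme R S) (λ ρ → IsStrong ρ × IsGScheme ρ)

-- Given ξ : P → R₁ ⊕ R₂, split P into the induced subposets P₁ = ξ⁻¹(R₁)
-- and P₂ = ξ⁻¹(R₂), apply ρ₁ to ξ restricted to P₁ and ρ₂ to ξ restricted to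
-- P₂, and glue the results into S₁ ⊕ S₂. The glued map is order preserving
-- because x ≤ y with ξ x ∈ R₂ forces ξ y ∈ R₂. It reveals which side each
-- point is sent to, hence P₁ and P₂, and then both ρᵢ-images, so injectivity
-- of the ρᵢ transfers. A fibre of ξ or of the glued map through x lies inside
-- the part Pᵢ containing x, where strict comparability is that of P, so the
-- G-classes at x are those of ξ|Pᵢ and ρᵢ(ξ|Pᵢ), which agree by hypothesis.

module Submission where

open import Defs
open import Data.Bool using (Bool; true; false; T)
open import Data.Bool.Properties using (T-irrelevant)
import Data.Empty.Irrelevant as Irrelevant
open import Data.Fin using (Fin; zero; suc; cast)
open import Data.Fin.Properties using (cast-involutive)
open import Data.Nat using (ℕ; suc; pred; NonZero)
open import Data.Nat.Properties using (suc-pred)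
open import Data.Product using (Σ; _×_; _,_; proj₁; proj₂; map)
open import Data.Product.Function.Dependent.Propositional using (Σ-↔)
open import Data.Product.Properties using (Σ-≡,≡→≡)
open import Data.Sum using (_⊎_; inj₁; inj₂; [_,_]′; fromInj₁; fromInj₂)
import Data.Sum as Sum
open import Data.Unit using (tt)
open import Data.Vec using (Vec; _∷_; lookup; tabulate; countᵇ)
open import Data.Vec.Properties using (lookup∘tabulate; tabulate-cong)
open import Function using (_↔_; Inverse; id; _∘_; const; mk↔ₛ′)
open import Function.Construct.Composition using (_↔-∘_)
open import Function.Construct.Identity using (↔-id)
open import Relation.Binary.Structures using (IsPartialOrder)
open import Relation.Binary.PropositionalEquality
  using (_≡_; refl; sym; trans; cong; subst; isEquivalence; module ≡-Reasoning)

private variable n : ℕ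

Members : Vec Bool n → Set
Members w = Σ (Fin _) (T ∘ lookup w)

Members↔Fin : (w : Vec Bool n) → Members w ↔ Fin (countᵇ id w)
Members↔Fin w = mk↔ₛ′ (toFin w) (fromFin w) (toFin∘fromFin w) (fromFin∘toFin w)
  where
  toFin : (w : Vec Bool n) → Members w → Fin (countᵇ id w)
  toFin (true ∷ w)  (zero , _)  = zero
  toFin (true ∷ w)  (suc i , p) = suc (toFin w (i , p))
  toFin (false ∷ w) (suc i , p) = toFin w (i , p)

  fromFin : (w : Vec Bool n) → Fin (countᵇ id w) → Members w
  fromFin (true ∷ w)  zero    = zero , tt
  fromFin (true ∷ w)  (suc j) = map suc id (fromFin w j)
  fromFin (false ∷ w) j       = map suc id (fromFin w j)

  toFin∘fromFin : (w : Vec Bool n) (j : Fin (countᵇ id w)) → toFin w (fromFin w j) ≡ j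
  toFin∘fromFin (true ∷ w)  zero    = refl
  toFin∘fromFin (true ∷ w)  (suc j) = cong suc (toFin∘fromFin w j)
  toFin∘fromFin (false ∷ w) j       = toFin∘fromFin w j

  fromFin∘toFin : (w : Vec Bool n) (i : Members w) → fromFin w (toFin w i) ≡ i
  fromFin∘toFin (true ∷ w)  (zero , _)  = refl
  fromFin∘toFin (true ∷ w)  (suc i , p) = cong (map suc id) (fromFin∘toFin w (i , p))
  fromFin∘toFin (false ∷ w) (suc i , p) = cong (map suc id) (fromFin∘toFin w (i , p))

countᵇ-nonZero : (w : Vec Bool n) (i : Fin n) → T (lookup w i) → NonZero (countᵇ id w)
countᵇ-nonZero (true ∷ w)  _       _ = _
countᵇ-nonZero (false ∷ w) (suc i) p = countᵇ-nonZero w i p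

Fin↔Fin-suc-pred : ∀ n .⦃ _ : NonZero n ⦄ → Fin n ↔ Fin (suc (pred n))
Fin↔Fin-suc-pred n =
  mk↔ₛ′ (cast e) (cast (sym e)) (cast-involutive e (sym e)) (cast-involutive (sym e) e)
  where e = sym (suc-pred n)

module Induced (P : FinPoset) where
  private
    module E = Inverse (enum P)
    module ≤ = IsPartialOrder (isPO P)

  Mask : Set
  Mask = Vec Bool (suc (k P))

  _∈_ : Carrier P → Mask → Set
  x ∈ w = T (lookup w (E.to x))

  Elem : Mask → Set
  Elem w = Σ (Carrier P) (_∈ w)

  Elem-≡ : ∀ {w} {a b : Elem w} → proj₁ a ≡ proj₁ b → a ≡ b
  Elem-≡ e = Σ-≡,≡→≡ (e , T-irrelevant _ _)

  induced : (w : Mask) .⦃ _ : NonZero (countᵇ id w) ⦄ → FinPoset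
  induced w = record
    { Carrier = Elem w
    ; _≤_     = λ a b → _≤_ P (proj₁ a) (proj₁ b)
    ; isPO    = record
      { isPreorder = record
        { isEquivalence = isEquivalence
        ; reflexive     = λ e → ≤.reflexive (cong proj₁ e)
        ; trans         = ≤.trans
        }
      ; antisym = λ a≤b b≤a → Elem-≡ {w} (≤.antisym a≤b b≤a)
      }
    ; k       = pred (countᵇ id w)
    ; enum    = Fin↔Fin-suc-pred _ ↔-∘ (Members↔Fin w ↔-∘ Σ-↔ (enum P) (↔-id _))
    }

  module _ {w : Mask} .⦃ _ : NonZero (countᵇ id w) ⦄ {Q Q′ : FinPoset} where

    <-induced⁻ : ∀ {a b} → _<_ (induced w) a b → _<_ P (proj₁ a) (proj₁ b)
    <-induced⁻ (a≤b , a≢b) = a≤b , a≢b ∘ Elem-≡ {w}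

    <-induced⁺ : ∀ {a b} → _<_ P (proj₁ a) (proj₁ b) → _<_ (induced w) a b
    <-induced⁺ (a≤b , a≢b) = a≤b , a≢b ∘ cong proj₁

    InG-embed : (g : Elem w → Carrier Q) (f : Carrier P → Carrier Q′) {x : Elem w}
      → (∀ z → g z ≡ g x → f (proj₁ z) ≡ f (proj₁ x))
      → ∀ {y} → InG (induced w) Q g x y → InG P Q′ f (proj₁ x) (proj₁ y)
    InG-embed g f fibre here         = here
    InG-embed g f fibre (step c e s) =
      step (InG-embed g f fibre c) (fibre _ e) (Sum.map <-induced⁻ <-induced⁻ s)

    InG-restrict : (g : Elem w → Carrier Q) (f : Carrier P → Carrier Q′) {x : Elem w}
      → (∀ z → f z ≡ f (proj₁ x) → Σ (z ∈ w) λ q → g (z , q) ≡ g x)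
      → ∀ {y} → InG P Q′ f (proj₁ x) y → Σ (y ∈ w) λ q → InG (induced w) Q g x (y , q)
    InG-restrict g f {x} fibre here = proj₂ x , here
    InG-restrict g f fibre (step {z = z} c e s) =
      let _ , c′ = InG-restrict g f fibre c
          q , e′ = fibre z e
      in  q , step c′ e′ (Sum.map <-induced⁺ <-induced⁺ s)

-- `restrict` is junk off the members.
record Summand (A R : FinPoset) : Set where
  field
    member             : Carrier R → Bool
    restrict           : Carrier R → Carrier A
    restrict-mono      : ∀ {r s} → .(T (member r)) → .(T (member s))
                       → _≤_ R r s → _≤_ A (restrict r) (restrict s)
    restrict-injective : ∀ {r s} → .(T (member r)) → .(T (member s))
                       → restrict r ≡ restrict s → r ≡ s

open Summand

module OnSummand {Rᵢ R Sᵢ S : FinPoset} (σ : Summand Rᵢ R) (τ : Summand Sᵢ S)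
                 (ρᵢ : HomScheme Rᵢ Sᵢ) (P : FinPoset) where
  open Induced P
  private module E = Inverse (enum P)

  -- Parts of P are masks on its enumeration rather than predicates, so that two
  -- maps with the same side pattern give the same induced poset without function
  -- extensionality; the membership hypotheses of `restrictHom` are irrelevant
  -- for the same reason (see `ρ↾-cong`).
  mask : Hom P R → Mask
  mask ξ = tabulate (member σ ∘ fun ξ ∘ E.from)

  lookup-mask : ∀ ξ x → lookup (mask ξ) (E.to x) ≡ member σ (fun ξ x)
  lookup-mask ξ x = trans (lookup∘tabulate (member σ ∘ fun ξ ∘ E.from) (E.to x))
                          (cong (member σ ∘ fun ξ) (E.strictlyInverseʳ x))

  ∈-mask⁻ : ∀ ξ {x} → x ∈ mask ξ → T (member σ (fun ξ x))
  ∈-mask⁻ ξ {x} = subst T (lookup-mask ξ x)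

  ∈-mask⁺ : ∀ ξ {x} → T (member σ (fun ξ x)) → x ∈ mask ξ
  ∈-mask⁺ ξ {x} = subst T (sym (lookup-mask ξ x))

  mask-nonZero : ∀ ξ {x} → T (member σ (fun ξ x)) → NonZero (countᵇ id (mask ξ))
  mask-nonZero ξ {x} p = countᵇ-nonZero (mask ξ) (E.to x) (∈-mask⁺ ξ p)

  restrictHom : (w : Mask) .⦃ _ : NonZero (countᵇ id w) ⦄ (ξ : Hom P R)
    → .(∀ {x} → x ∈ w → T (member σ (fun ξ x))) → Hom (induced w) Rᵢ
  restrictHom w ξ inside = record
    { fun  = restrict σ ∘ fun ξ ∘ proj₁
    ; mono = λ {a} {b} → restrict-mono σ (inside (proj₂ a)) (inside (proj₂ b)) ∘ mono ξ
    }

  ρ↾ : (w : Mask) .⦃ _ : NonZero (countᵇ id w) ⦄ (ξ : Hom P R)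
    → .(∀ {x} → x ∈ w → T (member σ (fun ξ x))) → Hom (induced w) Sᵢ
  ρ↾ w ξ inside = ρᵢ (induced w) (restrictHom w ξ inside)

  ρ↾-cong : ∀ {w w′} → w ≡ w′
    → .⦃ _ : NonZero (countᵇ id w) ⦄ .⦃ _ : NonZero (countᵇ id w′) ⦄ (ξ : Hom P R)
    → .(inside : ∀ {x} → x ∈ w → T (member σ (fun ξ x)))
    → .(inside′ : ∀ {x} → x ∈ w′ → T (member σ (fun ξ x)))
    → ∀ {z} (q : z ∈ w) (q′ : z ∈ w′)
    → fun (ρ↾ w ξ inside) (z , q) ≡ fun (ρ↾ w′ ξ inside′) (z , q′)
  ρ↾-cong {w} refl ξ inside _ {z} q q′ = cong (λ q → fun (ρ↾ w ξ inside) (z , q)) (T-irrelevant q q′)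

  partHom : (ξ : Hom P R) .⦃ _ : NonZero (countᵇ id (mask ξ)) ⦄ → Hom (induced (mask ξ)) Sᵢ
  partHom ξ = ρ↾ (mask ξ) ξ (∈-mask⁻ ξ)

  -- The nonemptiness witness is irrelevant, so all values `part ξ x` are read
  -- off one and the same hom `partHom ξ`.
  part : (ξ : Hom P R) (x : Carrier P) → T (member σ (fun ξ x)) → Carrier Sᵢ
  part ξ x p = fun (partHom ξ ⦃ mask-nonZero ξ p ⦄) (x , ∈-mask⁺ ξ p)

  part-≡ : ∀ ξ .⦃ _ : NonZero (countᵇ id (mask ξ)) ⦄ {x}
    (p : T (member σ (fun ξ x))) (q : x ∈ mask ξ) → part ξ x p ≡ fun (partHom ξ) (x , q)
  part-≡ ξ {x} p q = cong (λ q → fun (partHom ξ) (x , q)) (T-irrelevant _ q)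

  record Extends (ξ : Hom P R) (Φ : Carrier P → Carrier S) : Set where
    field
      member-≡   : ∀ z → member τ (Φ z) ≡ member σ (fun ξ z)
      restrict-≡ : .⦃ _ : NonZero (countᵇ id (mask ξ)) ⦄ (z : Elem (mask ξ))
                 → restrict τ (Φ (proj₁ z)) ≡ fun (partHom ξ) z

  open Extends
  open ≡-Reasoning

  module _ {ξ : Hom P R} {Φ : Carrier P → Carrier S} (ext : Extends ξ Φ) where

    Φ-member : ∀ z → T (member σ (fun ξ z)) → T (member τ (Φ z))
    Φ-member z = subst T (sym (member-≡ ext z))

    Φ-fibre-member : ∀ {x z} → T (member σ (fun ξ x)) → Φ z ≡ Φ x → T (member σ (fun ξ z))
    Φ-fibre-member {x} {z} p e =
      subst T (trans (sym (member-≡ ext x)) (trans (cong (member τ) (sym e)) (member-≡ ext z))) p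

    InG-on-summand : IsGScheme ρᵢ → ∀ {x} → T (member σ (fun ξ x)) → ∀ y
      → (InG P S Φ x y → InG P R (fun ξ) x y) × (InG P R (fun ξ) x y → InG P S Φ x y)
    InG-on-summand G {x} p y = ρ-chain⇒ξ-chain , ξ-chain⇒ρ-chain
      where
      instance
        _ : NonZero (countᵇ id (mask ξ))
        _ = mask-nonZero ξ p

      x̂ : Elem (mask ξ)
      x̂ = x , ∈-mask⁺ ξ p

      h : Hom (induced (mask ξ)) Rᵢ
      h = restrictHom (mask ξ) ξ (∈-mask⁻ ξ)

      g : Elem (mask ξ) → Carrier Sᵢ
      g = fun (partHom ξ)

      Φ-fibre : ∀ z → Φ z ≡ Φ x → Σ (z ∈ mask ξ) λ q → g (z , q) ≡ g x̂
      Φ-fibre z e = q , trans (sym (restrict-≡ ext (z , q)))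
                              (trans (cong (restrict τ) e) (restrict-≡ ext x̂))
        where q = ∈-mask⁺ ξ (Φ-fibre-member p e)

      h-fibre : ∀ z → fun h z ≡ fun h x̂ → fun ξ (proj₁ z) ≡ fun ξ x
      h-fibre (z , q) = restrict-injective σ (∈-mask⁻ ξ q) p

      ξ-fibre : ∀ z → fun ξ z ≡ fun ξ x → Σ (z ∈ mask ξ) λ q → fun h (z , q) ≡ fun h x̂
      ξ-fibre z e = ∈-mask⁺ ξ (subst (T ∘ member σ) (sym e) p) , cong (restrict σ) e

      g-fibre : ∀ z → g z ≡ g x̂ → Φ (proj₁ z) ≡ Φ x
      g-fibre (z , q) e = restrict-injective τ (Φ-member z (∈-mask⁻ ξ q)) (Φ-member x p)
        (trans (restrict-≡ ext (z , q)) (trans e (sym (restrict-≡ ext x̂))))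

      ρ-chain⇒ξ-chain : InG P S Φ x y → InG P R (fun ξ) x y
      ρ-chain⇒ξ-chain c = let q , c′ = InG-restrict g Φ Φ-fibre c
                          in  InG-embed (fun h) (fun ξ) h-fibre (proj₁ (G _ h x̂ (y , q)) c′)

      ξ-chain⇒ρ-chain : InG P R (fun ξ) x y → InG P S Φ x y
      ξ-chain⇒ρ-chain c = let q , c′ = InG-restrict (fun h) (fun ξ) ξ-fibre c
                          in  InG-embed g Φ g-fibre (proj₂ (G _ h x̂ (y , q)) c′)

  injective-on-summand : IsStrong ρᵢ → ∀ {ξ ξ′ Φ Φ′} → Extends ξ Φ → Extends ξ′ Φ′
    → (∀ z → Φ z ≡ Φ′ z) → ∀ {x} → T (member σ (fun ξ x)) → fun ξ x ≡ fun ξ′ x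
  injective-on-summand strong {ξ} {ξ′} {Φ} {Φ′} ext ext′ Φ≗Φ′ {x} p =
    restrict-injective σ p (subst T (same-side x) p) (strong _ h h′ ρh≗ρh′ (x , ∈-mask⁺ ξ p))
    where
    instance
      _ : NonZero (countᵇ id (mask ξ))
      _ = mask-nonZero ξ p

    same-side : ∀ z → member σ (fun ξ z) ≡ member σ (fun ξ′ z)
    same-side z = trans (sym (member-≡ ext z)) (trans (cong (member τ) (Φ≗Φ′ z)) (member-≡ ext′ z))

    inside′ : ∀ {z} → z ∈ mask ξ → T (member σ (fun ξ′ z))
    inside′ {z} q = subst T (same-side z) (∈-mask⁻ ξ q)

    h h′ : Hom (induced (mask ξ)) Rᵢ
    h  = restrictHom (mask ξ) ξ (∈-mask⁻ ξ)
    h′ = restrictHom (mask ξ) ξ′ inside′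

    ρh≗ρh′ : ρᵢ _ h ≗H ρᵢ _ h′
    ρh≗ρh′ (z , q) = begin
      fun (partHom ξ) (z , q)       ≡⟨ sym (restrict-≡ ext (z , q)) ⟩
      restrict τ (Φ z)              ≡⟨ cong (restrict τ) (Φ≗Φ′ z) ⟩
      restrict τ (Φ′ z)             ≡⟨ restrict-≡ ext′ ⦃ nz′ ⦄ (z , q′) ⟩
      fun (partHom ξ′ ⦃ nz′ ⦄) (z , q′)
        ≡⟨ ρ↾-cong mask-≡ ⦃ nz′ ⦄ ξ′ (∈-mask⁻ ξ′) inside′ q′ q ⟩
      fun (ρᵢ _ h′) (z , q)         ∎
      where
      nz′ = mask-nonZero ξ′ (inside′ q)
      q′  = ∈-mask⁺ ξ′ (inside′ q)
      mask-≡ : mask ξ′ ≡ mask ξ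
      mask-≡ = tabulate-cong (sym ∘ same-side ∘ E.from)

point : (A : FinPoset) → Carrier A
point A = Inverse.from (enum A) zero

module _ {A B : Set} where

  left? right? : A ⊎ B → Bool
  left? (inj₁ _) = true
  left? (inj₂ _) = false
  right? (inj₁ _) = false
  right? (inj₂ _) = true

  side : (r : A ⊎ B) → T (left? r) ⊎ T (right? r)
  side (inj₁ _) = inj₁ tt
  side (inj₂ _) = inj₂ tt

module _ {A B C D : Set} where

  glue : (r : A ⊎ B) → (T (left? r) → C) → (T (right? r) → D) → C ⊎ D
  glue (inj₁ _) f _ = inj₁ (f tt)
  glue (inj₂ _) _ g = inj₂ (g tt)

  left?-glue : ∀ r f g → left? (glue r f g) ≡ left? r
  left?-glue (inj₁ _) _ _ = refl
  left?-glue (inj₂ _) _ _ = refl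

  right?-glue : ∀ r f g → right? (glue r f g) ≡ right? r
  right?-glue (inj₁ _) _ _ = refl
  right?-glue (inj₂ _) _ _ = refl

  fromInj₁-glue : ∀ r {f g} (p : T (left? r)) (d : D → C) → fromInj₁ d (glue r f g) ≡ f p
  fromInj₁-glue (inj₁ _) tt _ = refl

  fromInj₂-glue : ∀ r {f g} (p : T (right? r)) (d : C → D) → fromInj₂ d (glue r f g) ≡ g p
  fromInj₂-glue (inj₂ _) tt _ = refl

glue-mono : ∀ {R₁ R₂ S₁ S₂ : FinPoset} {r s : Carrier (R₁ ⊕ R₂)}
  {f : T (left? r) → Carrier S₁} {g : T (right? r) → Carrier S₂}
  {f′ : T (left? s) → Carrier S₁} {g′ : T (right? s) → Carrier S₂}
  → _≤_ (R₁ ⊕ R₂) r s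
  → (∀ p q → _≤_ S₁ (f p) (f′ q)) → (∀ p q → _≤_ S₂ (g p) (g′ q))
  → _≤_ (S₁ ⊕ S₂) (glue r f g) (glue s f′ g′)
glue-mono (≤-AA _) f≤f′ _    = ≤-AA (f≤f′ tt tt)
glue-mono ≤-AB     _    _    = ≤-AB
glue-mono (≤-BB _) _    g≤g′ = ≤-BB (g≤g′ tt tt)

⊕-left : (A B : FinPoset) → Summand A (A ⊕ B)
⊕-left A B = record
  { member             = left?
  ; restrict           = fromInj₁ (const (point A))
  ; restrict-mono      = restrict-mono′
  ; restrict-injective = restrict-injective′
  }
  where
  restrict-mono′ : ∀ {r s} → .(T (left? r)) → .(T (left? s)) → _≤_ (A ⊕ B) r s
    → _≤_ A (fromInj₁ (const (point A)) r) (fromInj₁ (const (point A)) s)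
  restrict-mono′ _ _ (≤-AA a≤a′) = a≤a′
  restrict-mono′ _ q ≤-AB        = Irrelevant.⊥-elim q
  restrict-mono′ p _ (≤-BB _)    = Irrelevant.⊥-elim p

  restrict-injective′ : ∀ {r s} → .(T (left? r)) → .(T (left? s))
    → fromInj₁ (const (point A)) r ≡ fromInj₁ (const (point A)) s → r ≡ s
  restrict-injective′ {inj₁ _} {inj₁ _} _ _ e = cong inj₁ e
  restrict-injective′ {inj₁ _} {inj₂ _} _ q _ = Irrelevant.⊥-elim q
  restrict-injective′ {inj₂ _} p _ _          = Irrelevant.⊥-elim p

⊕-right : (A B : FinPoset) → Summand B (A ⊕ B)
⊕-right A B = record
  { member             = right?
  ; restrict           = fromInj₂ (const (point B))
  ; restrict-mono      = restrict-mono′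
  ; restrict-injective = restrict-injective′
  }
  where
  restrict-mono′ : ∀ {r s} → .(T (right? r)) → .(T (right? s)) → _≤_ (A ⊕ B) r s
    → _≤_ B (fromInj₂ (const (point B)) r) (fromInj₂ (const (point B)) s)
  restrict-mono′ p _ (≤-AA _)    = Irrelevant.⊥-elim p
  restrict-mono′ p _ ≤-AB        = Irrelevant.⊥-elim p
  restrict-mono′ _ _ (≤-BB b≤b′) = b≤b′

  restrict-injective′ : ∀ {r s} → .(T (right? r)) → .(T (right? s))
    → fromInj₂ (const (point B)) r ≡ fromInj₂ (const (point B)) s → r ≡ s
  restrict-injective′ {inj₂ _} {inj₂ _} _ _ e = cong inj₂ e
  restrict-injective′ {inj₂ _} {inj₁ _} _ q _ = Irrelevant.⊥-elim q
  restrict-injective′ {inj₁ _} p _ _          = Irrelevant.⊥-elim p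

module OrdinalSumScheme {R₁ R₂ S₁ S₂ : FinPoset}
                        (ρ₁ : HomScheme R₁ S₁) (ρ₂ : HomScheme R₂ S₂) where
  module Left  = OnSummand (⊕-left  R₁ R₂) (⊕-left  S₁ S₂) ρ₁
  module Right = OnSummand (⊕-right R₁ R₂) (⊕-right S₁ S₂) ρ₂

  ρ⊕-fun : (P : FinPoset) → Hom P (R₁ ⊕ R₂) → Carrier P → Carrier (S₁ ⊕ S₂)
  ρ⊕-fun P ξ x = glue (fun ξ x) (Left.part P ξ x) (Right.part P ξ x)

  ρ⊕ : HomScheme (R₁ ⊕ R₂) (S₁ ⊕ S₂)
  ρ⊕ P ξ = record
    { fun  = ρ⊕-fun P ξ
    ; mono = λ x≤y → glue-mono (mono ξ x≤y)
        (λ p _ → mono (Left.partHom P ξ ⦃ Left.mask-nonZero P ξ p ⦄) x≤y)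
        (λ p _ → mono (Right.partHom P ξ ⦃ Right.mask-nonZero P ξ p ⦄) x≤y)
    }

  extends-left : ∀ P ξ → Left.Extends P ξ (ρ⊕-fun P ξ)
  extends-left P ξ = record
    { member-≡   = λ z → left?-glue (fun ξ z) _ _
    ; restrict-≡ = λ (z , q) → let p = Left.∈-mask⁻ P ξ q in
        trans (fromInj₁-glue (fun ξ z) p _) (Left.part-≡ P ξ p q)
    }

  extends-right : ∀ P ξ → Right.Extends P ξ (ρ⊕-fun P ξ)
  extends-right P ξ = record
    { member-≡   = λ z → right?-glue (fun ξ z) _ _
    ; restrict-≡ = λ (z , q) → let p = Right.∈-mask⁻ P ξ q in
        trans (fromInj₂-glue (fun ξ z) p _) (Right.part-≡ P ξ p q)
    }

  ρ⊕-strong : IsStrong ρ₁ → IsStrong ρ₂ → IsStrong ρ⊕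
  ρ⊕-strong s₁ s₂ P ξ ξ′ ρξ≗ρξ′ x = [
      Left.injective-on-summand P s₁ (extends-left P ξ) (extends-left P ξ′) ρξ≗ρξ′ {x}
    , Right.injective-on-summand P s₂ (extends-right P ξ) (extends-right P ξ′) ρξ≗ρξ′ {x}
    ]′ (side (fun ξ x))

  ρ⊕-G : IsGScheme ρ₁ → IsGScheme ρ₂ → IsGScheme ρ⊕
  ρ⊕-G G₁ G₂ P ξ x y = [
      (λ p → Left.InG-on-summand P (extends-left P ξ) G₁ {x} p y)
    , (λ p → Right.InG-on-summand P (extends-right P ξ) G₂ {x} p y)
    ]′ (side (fun ξ x))

open OrdinalSumScheme using (ρ⊕; ρ⊕-strong; ρ⊕-G)

proposition4 : (R₁ R₂ S₁ S₂ : FinPoset)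
    → ((R₁ ⊑ S₁) → (R₂ ⊑ S₂) → ((R₁ ⊕ R₂) ⊑ (S₁ ⊕ S₂)))
    × ((R₁ ⊑G S₁) → (R₂ ⊑G S₂) → ((R₁ ⊕ R₂) ⊑G (S₁ ⊕ S₂)))
proposition4 R₁ R₂ S₁ S₂ =
    (λ (ρ₁ , s₁) (ρ₂ , s₂) → ρ⊕ ρ₁ ρ₂ , ρ⊕-strong ρ₁ ρ₂ s₁ s₂)
  , (λ (ρ₁ , s₁ , G₁) (ρ₂ , s₂ , G₂) →
       ρ⊕ ρ₁ ρ₂ , ρ⊕-strong ρ₁ ρ₂ s₁ s₂ , ρ⊕-G ρ₁ ρ₂ G₁ G₂)
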